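{- (Completeness.) For any statement $s$, state predicate $U$ and setoid trace predicate $P$, if for all states $\sigma$ and traces $\tau$, $\sigma\models U$ and $s,\sigma\Rightarrow\tau$ imply $\tau\models P$, then $\vdash\{U\}\,s\,\{P\}$ is derivable in the trace-based Hoare logic.
   Context: While statements: $s ::= x:=e \mid \mathsf{skip}\mid s_0;s_1\mid \mathsf{if}\ e\ \mathsf{then}\ s_t\ \mathsf{else}\ s_f\mid \mathsf{while}\ e\ \mathsf{do}\ s_t$, with $x$ integer variables and $e$ arithmetic expressions; a state $\sigma$ assigns integers to variables, $[\![e]\!]\sigma$ is the value, $\sigma\models e$ means $e$ is true in $\sigma$. The metatheory is constructive; assertions are arbitrary predicates expressible in the metalogic. Traces are coinductive: $\langle\sigma\rangle$, and $\sigma::\tau$ for a trace $\tau$; bisimilarity $\approx$ is coinductive ($\langle\sigma\rangle\approx\langle\sigma\rangle$; $\sigma::\tau\approx\sigma::\tau'$ if $\tau\approx\tau'$); $\mathit{hd}\langle\sigma\rangle=\mathit{hd}(\sigma::\tau)=\sigma$. Evaluation $s,\sigma\Rightarrow\tau$ and extended evaluation $s,\tau\Rightarrow^*\tau'$ are defined simultaneously coinductively by: $x:=e,\sigma\Rightarrow\sigma::\langle\sigma[x\mapsto[\![e]\!]\sigma]\rangle$; $\mathsf{skip},\sigma\Rightarrow\langle\sigma\rangle$; $s_0;s_1,\sigma\Rightarrow\tau'$ if $s_0,\sigma\Rightarrow\tau$ and $s_1,\tau\Rightarrow^*\tau'$; $\mathsf{if}\ e\ \mathsf{then}\ s_t\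 \mathsf{else}\ s_f,\sigma\Rightarrow\tau$ if $\sigma\models e$ and $s_t,\sigma::\langle\sigma\rangle\Rightarrow^*\tau$, or if $\sigma\not\models e$ and $s_f,\sigma::\langle\sigma\rangle\Rightarrow^*\tau$; $\mathsf{while}\ e\ \mathsf{do}\ s_t,\sigma\Rightarrow\tau'$ if $\sigma\models e$, $s_t,\sigma::\langle\sigma\rangle\Rightarrow^*\tau$ and $\mathsf{while}\ e\ \mathsf{do}\ s_t,\tau\Rightarrow^*\tau'$; $\mathsf{while}\ e\ \mathsf{do}\ s_t,\sigma\Rightarrow\sigma::\langle\sigma\rangle$ if $\sigma\not\models e$; $s,\langle\sigma\rangle\Rightarrow^*\tau$ if $s,\sigma\Rightarrow\tau$; $s,\sigma::\tau\Rightarrow^*\sigma::\tau'$ if $s,\tau\Rightarrow^*\tau'$. State predicates are arbitrary; trace predicates are setoid predicates (invariant under $\approx$); $\wedge,\neg,\exists$ are pointwise; $\models$ is also entailment. $\langle U\rangle$ holds exactly of $\langle\sigma\rangle$ with $\sigma\models U$; $\mathrm{dup}(U)$ exactly of $\sigma::\langle\sigma\rangle$ with $\sigma\models U$; $U[x\mapsto e]$ exactly of $\sigma::\langle\sigma[x\mapsto[\![e]\!]\sigma]\rangle$ with $\sigma\models U$. $\mathrm{follows}_Q(\tau,\tau')$ is coinductive: $\mathrm{follows}_Q(\langle\sigma\rangle,\tau)$ if $\mathit{hd}\,\tau=\sigma$ and $\tau\models Q$; $\mathrm{follows}_Q(\sigma::\tau,\sigma::\tau')$ if $\mathrm{follows}_Q(\tau,\tau')$.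 $\tau'\models P\ast\ast Q$ iff $\exists\tau$, $\tau\models P$ and $\mathrm{follows}_Q(\tau,\tau')$ (chains associate to the right). $P^{\dagger}$ is coinductive: $\tau\models P^{\dagger}$ if $\tau\models\langle\mathsf{true}\rangle$; $\tau'\models P^{\dagger}$ if $\exists\tau$, $\tau\models P$ and $\mathrm{follows}_{P^{\dagger}}(\tau,\tau')$. The trace-based Hoare logic derives $\{U\}\,s\,\{P\}$ inductively by: $\{U\}\,x:=e\,\{U[x\mapsto e]\}$; $\{U\}\,\mathsf{skip}\,\{\langle U\rangle\}$; from $\{U\}\,s_0\,\{P\ast\ast\langle V\rangle\}$ and $\{V\}\,s_1\,\{Q\}$ infer $\{U\}\,s_0;s_1\,\{P\ast\ast Q\}$; from $\{e\wedge U\}\,s_t\,\{P\}$ and $\{\neg e\wedge U\}\,s_f\,\{P\}$ infer $\{U\}\,\mathsf{if}\ e\ \mathsf{then}\ s_t\ \mathsf{else}\ s_f\,\{\mathrm{dup}(U)\ast\ast P\}$; from $U\models I$ and $\{e\wedge I\}\,s_t\,\{P\ast\ast\langle I\rangle\}$ infer $\{U\}\,\mathsf{while}\ e\ \mathsf{do}\ s_t\,\{\mathrm{dup}(U)\ast\ast(P\ast\ast\mathrm{dup}(I))^{\dagger}\ast\ast\langle\neg e\rangle\}$; from $U\models U'$, $\{U'\}\,s\,\{P'\}$, $P'\models P$ infer $\{U\}\,s\,\{P\}$; from $\forall z.\ \{U_z\}\,s\,\{P_z\}$ infer $\{\exists z.U_z\}\,s\,\{\exists z.P_z\}$. -}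

module Defs where

-- We therefore encode
--   * coinductive traces as their final-coalgebra "observation" representation
--     (a head state plus the sequence of further states; the trace ends at the
--     first 'nothing'), observed through the view 'out', and
--   * every coinductively defined predicate/relation (bisimilarity,
--     evaluation, extended evaluation, follows, dagger) as the existence of a
--     possibly infinite (non-well-founded) derivation tree built from the
--     paper's rules, given as a labelling of all finite paths.

open import Data.Nat using (ℕ; zero; suc; _≡ᵇ_)
open import Data.Integer using (ℤ; 0ℤ; 1ℤ) renaming (_+_ to _+ℤ_; _-_ to _-ℤ_; _*_ to _*ℤ_)
import Data.Integer as ℤ
open import Data.Bool using (Bool; true; false; if_then_else_)
open import Data.Maybe using (Maybe; just; nothing)
open import Data.List using (List; []; _∷_)
open import Data.Fin using (Fin; toℕ)
open import Data.Product using (Σ; _×_; _,_; proj₁; proj₂)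
open import Data.Sum using (_⊎_; inj₁; inj₂)
open import Data.Unit using (⊤; tt)
open import Data.Empty using (⊥)
open import Relation.Nullary using (¬_)
open import Relation.Binary.PropositionalEquality using (_≡_)

Var : Set
Var = ℕ

data Expr : Set where
  lit  : ℤ → Expr
  var  : Var → Expr
  _⊕_  : Expr → Expr → Expr
  _⊖_  : Expr → Expr → Expr
  _⊗_  : Expr → Expr → Expr
  _≺_  : Expr → Expr → Expr   -- 1 if less-than, else 0
  _≐_  : Expr → Expr → Expr   -- 1 if equal, else 0
  !_   : Expr → Expr          -- 1 if operand is 0, else 0

data Stmt : Set where
  _≔_    : Var → Expr → Stmt
  skip   : Stmt
  _⨾_    : Stmt → Stmt → Stmt
  if_then_else′_ : Expr → Stmt → Stmt → Stmt
  while_loop_ : Expr → Stmt → Stmt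

State : Set
State = Var → ℤ

b2z : Bool → ℤ
b2z true  = 1ℤ
b2z false = 0ℤ

⟦_⟧ : Expr → State → ℤ
⟦ lit n ⟧ σ = n
⟦ var x ⟧ σ = σ x
⟦ e ⊕ f ⟧ σ = ⟦ e ⟧ σ +ℤ ⟦ f ⟧ σ
⟦ e ⊖ f ⟧ σ = ⟦ e ⟧ σ -ℤ ⟦ f ⟧ σ
⟦ e ⊗ f ⟧ σ = ⟦ e ⟧ σ *ℤ ⟦ f ⟧ σ
⟦ e ≺ f ⟧ σ = b2z (Data.Bool.not (⟦ f ⟧ σ ℤ.≤ᵇ ⟦ e ⟧ σ))
⟦ e ≐ f ⟧ σ = b2z ((⟦ e ⟧ σ ℤ.≤ᵇ ⟦ f ⟧ σ) Data.Bool.∧ (⟦ f ⟧ σ ℤ.≤ᵇ ⟦ e ⟧ σ))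
⟦ ! e ⟧ σ = b2z ((⟦ e ⟧ σ ℤ.≤ᵇ 0ℤ) Data.Bool.∧ (0ℤ ℤ.≤ᵇ ⟦ e ⟧ σ))

-- σ ⊨ e : e is true in σ (C convention: nonzero value)
_⊨_ : State → Expr → Set
σ ⊨ e = ¬ (⟦ e ⟧ σ ≡ 0ℤ)

_[_↦_] : State → Var → ℤ → State
(σ [ x ↦ v ]) y = if x ≡ᵇ y then v else σ y

record Trace : Set where
  constructor mkTrace
  field
    hd   : State
    rest : ℕ → Maybe State   -- states after the head; trace ends at first nothing

open Trace public

⟨_⟩ : State → Trace
⟨ σ ⟩ = mkTrace σ (λ _ → nothing)

infixr 5 _∷ᵗ_
_∷ᵗ_ : State → Trace → Trace
σ ∷ᵗ τ = mkTrace σ (λ { zero → just (hd τ) ; (suc n) → rest τ n })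

-- one-step observation of a trace (the coinductive "pattern match")
data View : Set where
  nilV  : State → View
  consV : State → Trace → View

viewFrom : State → (ℕ → Maybe State) → Maybe State → View
viewFrom σ r nothing   = nilV σ
viewFrom σ r (just σ′) = consV σ (mkTrace σ′ (λ n → r (suc n)))

out : Trace → View
out τ = viewFrom (hd τ) (rest τ) (rest τ 0)

-- Generic coinductively defined predicates: possibly infinite derivation
-- trees over a rule system.  For each judgment i, 'rules i' gives the rule
-- instances concluding i: side conditions ('Inst'), and the recursive
-- premises ('prem').

record Sig (I : Set) : Set₁ where
  constructor sig
  field
    Inst  : Set
    arity : Inst → ℕ
    prem  : (r : Inst) → Fin (arity r) → I

leaf : {I : Set} → Set → Sig I
leaf C = sig C (λ _ → 0) (λ _ ())

-- the greatest fixed point: a labelling of every finite path (child k of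
-- the node at path p is the node at path k ∷ p) by a judgment and a rule
-- instance concluding it, whose premises label the children.
record ν {I : Set} (rules : I → Sig I) (i : I) : Set where
  field
    label : List ℕ → Σ I (λ j → Sig.Inst (rules j))
    root  : proj₁ (label []) ≡ i
    next  : (p : List ℕ)
            (k : Fin (Sig.arity (rules (proj₁ (label p))) (proj₂ (label p)))) →
            proj₁ (label (toℕ k ∷ p)) ≡
              Sig.prem (rules (proj₁ (label p))) (proj₂ (label p)) k

NilOf : View → State → Set
NilOf (nilV σ′)    σ = σ′ ≡ σ
NilOf (consV _ _)  σ = ⊥

DupOf : View → State → State → Set
DupOf (nilV _)     σ σ′ = ⊥
DupOf (consV σ₀ t) σ σ′ = (σ₀ ≡ σ) × NilOf (out t) σ′

bisimV : View → View → Sig (Trace × Trace)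
bisimV (nilV σ)    (nilV σ′)     = leaf (σ ≡ σ′)
bisimV (consV σ t) (consV σ′ t′) = sig (σ ≡ σ′) (λ _ → 1) (λ _ _ → (t , t′))
bisimV _ _ = leaf ⊥

bisimRules : Trace × Trace → Sig (Trace × Trace)
bisimRules (τ , τ′) = bisimV (out τ) (out τ′)

_≈_ : Trace → Trace → Set
τ ≈ τ′ = ν bisimRules (τ , τ′)

data EvJ : Set where
  ev  : Stmt → State → Trace → EvJ
  evx : Stmt → Trace → Trace → EvJ

data WhileInst (e : Expr) (σ : State) (τ : Trace) : Set where
  wTrue  : σ ⊨ e → Trace → WhileInst e σ τ
  wFalse : ¬ (σ ⊨ e) → DupOf (out τ) σ σ → WhileInst e σ τ

evxCons : Stmt → State → Trace → View → Sig EvJ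
evxCons s σ t (nilV _)      = leaf ⊥
evxCons s σ t (consV σ′ t′) = sig (σ′ ≡ σ) (λ _ → 1) (λ _ _ → evx s t t′)

evxRules : Stmt → View → Trace → Sig EvJ
evxRules s (nilV σ)    τ = sig ⊤ (λ _ → 1) (λ _ _ → ev s σ τ)
evxRules s (consV σ t) τ = evxCons s σ t (out τ)

evRules : EvJ → Sig EvJ
evRules (ev (x ≔ e) σ τ) = leaf (DupOf (out τ) σ (σ [ x ↦ ⟦ e ⟧ σ ]))
evRules (ev skip σ τ)    = leaf (NilOf (out τ) σ)
evRules (ev (s₀ ⨾ s₁) σ τ′) =
  sig Trace (λ _ → 2)
      (λ { τ Fin.zero → ev s₀ σ τ ; τ (Fin.suc _) → evx s₁ τ τ′ })
evRules (ev (if e then sₜ else′ s_f) σ τ) =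
  sig ((σ ⊨ e) ⊎ ¬ (σ ⊨ e)) (λ _ → 1)
      (λ { (inj₁ _) _ → evx sₜ (σ ∷ᵗ ⟨ σ ⟩) τ
         ; (inj₂ _) _ → evx s_f (σ ∷ᵗ ⟨ σ ⟩) τ })
evRules (ev (while e loop sₜ) σ τ′) =
  sig (WhileInst e σ τ′)
      (λ { (wTrue _ _) → 2 ; (wFalse _ _) → 0 })
      (λ { (wTrue _ τ) Fin.zero → evx sₜ (σ ∷ᵗ ⟨ σ ⟩) τ
         ; (wTrue _ τ) (Fin.suc _) → evx (while e loop sₜ) τ τ′
         ; (wFalse _ _) () })
evRules (evx s τ τ′) = evxRules s (out τ) τ′

_,_⇒_ : Stmt → State → Trace → Set
s , σ ⇒ τ = ν evRules (ev s σ τ)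

_,_⇒*_ : Stmt → Trace → Trace → Set
s , τ ⇒* τ′ = ν evRules (evx s τ τ′)

Assn : Set₁
Assn = State → Set

-- trace predicates (setoid-ness is imposed separately by IsSetoid)
TPred : Set₁
TPred = Trace → Set

IsSetoid : TPred → Set
IsSetoid P = ∀ τ τ′ → τ ≈ τ′ → P τ → P τ′

_⊨ₛ_ : Assn → Assn → Set
U ⊨ₛ V = ∀ σ → U σ → V σ

_⊨ₜ_ : TPred → TPred → Set
P ⊨ₜ Q = ∀ τ → P τ → Q τ

_∧ₑ_ : Expr → Assn → Assn
(e ∧ₑ U) σ = (σ ⊨ e) × U σ

_∧¬ₑ_ : Expr → Assn → Assn
(e ∧¬ₑ U) σ = ¬ (σ ⊨ e) × U σ

⟪_⟫V : Assn → View → Set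
⟪ U ⟫V (nilV σ)    = U σ
⟪ U ⟫V (consV _ _) = ⊥

⟪_⟫ : Assn → TPred
⟪ U ⟫ τ = ⟪ U ⟫V (out τ)

IsNil : TPred
IsNil = ⟪ (λ _ → ⊤) ⟫

dupV : Assn → View → Set
dupV U (nilV _)    = ⊥
dupV U (consV σ t) = NilOf (out t) σ × U σ

dup : Assn → TPred
dup U τ = dupV U (out τ)

updV : Assn → Var → Expr → View → Set
updV U x e (nilV _)    = ⊥
updV U x e (consV σ t) = NilOf (out t) (σ [ x ↦ ⟦ e ⟧ σ ]) × U σ

_[_↦ₜ_] : Assn → Var → Expr → TPred
(U [ x ↦ₜ e ]) τ = updV U x e (out τ)

followsCons : State → Trace → View → Sig (Trace × Trace)
followsCons σ t (nilV _)      = leaf ⊥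
followsCons σ t (consV σ′ t′) = sig (σ ≡ σ′) (λ _ → 1) (λ _ _ → (t , t′))

followsRules : TPred → Trace × Trace → Sig (Trace × Trace)
followsRules Q (τ , τ′) with out τ
... | nilV σ    = leaf ((hd τ′ ≡ σ) × Q τ′)
... | consV σ t = followsCons σ t (out τ′)

follows : TPred → Trace → Trace → Set
follows Q τ τ′ = ν (followsRules Q) (τ , τ′)

infixr 4 _**_
_**_ : TPred → TPred → TPred
(P ** Q) τ′ = Σ Trace (λ τ → P τ × follows Q τ τ′)

-- P†, defined simultaneously with follows_{P†} (nested coinduction)
data DagJ : Set where
  dag  : Trace → DagJ
  dfol : Trace → Trace → DagJ

dagCons : State → Trace → View → Sig DagJ
dagCons σ t (nilV _)      = leaf ⊥
dagCons σ t (consV σ′ t′) = sig (σ ≡ σ′) (λ _ → 1) (λ _ _ → dfol t t′)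

dagRules : TPred → DagJ → Sig DagJ
dagRules P (dag τ′) =
  sig (IsNil τ′ ⊎ Σ Trace P)
      (λ { (inj₁ _) → 0 ; (inj₂ _) → 1 })
      (λ { (inj₁ _) () ; (inj₂ (τ , _)) _ → dfol τ τ′ })
dagRules P (dfol τ τ′) with out τ
... | nilV σ    = sig (hd τ′ ≡ σ) (λ _ → 1) (λ _ _ → dag τ′)
... | consV σ t = dagCons σ t (out τ′)

_† : TPred → TPred
(P †) τ = ν (dagRules P) (dag τ)

-- The trace-based Hoare logic  ⊢ {U} s {P}
-- (every trace-predicate metavariable of a rule ranges over setoid
--  predicates, expressed by IsSetoid side conditions)

data ⊢[_]_[_] : Assn → Stmt → TPred → Set₁ where
  h-assign : ∀ {U x e} → ⊢[ U ] (x ≔ e) [ U [ x ↦ₜ e ] ]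
  h-skip   : ∀ {U} → ⊢[ U ] skip [ ⟪ U ⟫ ]
  h-seq    : ∀ {U V P Q s₀ s₁} → IsSetoid P → IsSetoid Q →
             ⊢[ U ] s₀ [ P ** ⟪ V ⟫ ] → ⊢[ V ] s₁ [ Q ] →
             ⊢[ U ] (s₀ ⨾ s₁) [ P ** Q ]
  h-if     : ∀ {U P e sₜ s_f} → IsSetoid P →
             ⊢[ e ∧ₑ U ] sₜ [ P ] → ⊢[ e ∧¬ₑ U ] s_f [ P ] →
             ⊢[ U ] (if e then sₜ else′ s_f) [ dup U ** P ]
  h-while  : ∀ {U I P e sₜ} → IsSetoid P → U ⊨ₛ I →
             ⊢[ e ∧ₑ I ] sₜ [ P ** ⟪ I ⟫ ] →
             ⊢[ U ] (while e loop sₜ)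
               [ dup U ** ((P ** dup I) † ** ⟪ (λ σ → ¬ (σ ⊨ e)) ⟫) ]
  h-conseq : ∀ {U U′ P P′ s} → IsSetoid P′ → IsSetoid P →
             U ⊨ₛ U′ → ⊢[ U′ ] s [ P′ ] → P′ ⊨ₜ P → ⊢[ U ] s [ P ]
  h-ex     : ∀ {Z : Set} {U : Z → Assn} {P : Z → TPred} {s} →
             (∀ z → IsSetoid (P z)) → (∀ z → ⊢[ U z ] s [ P z ]) →
             ⊢[ (λ σ → Σ Z (λ z → U z σ)) ] s [ (λ τ → Σ Z (λ z → P z τ)) ]

module Submission where

-- Completeness of the trace-based Hoare logic, via strongest postconditions.
--
-- For a precondition U and a statement s let  sp U s  be the trace predicate
-- "τ is an evaluation trace of s from some state satisfying U".  It is a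
-- setoid predicate, because evaluation respects bisimilarity of its output.
-- The heart of the proof is  ⊢[ U ] s [ sp U s ]  for every s and U, by
-- structural induction on s: each case applies the Hoare rule for s to the
-- strongest postconditions of the substatements and weakens the rule's
-- postcondition to  sp U s, i.e. it reassembles an evaluation derivation from
-- a decomposition of the trace into **-, dup- and †-pieces.  The theorem is
-- then one application of the consequence rule.

open import Defs
open import Data.Nat using (ℕ; zero; suc)
open import Data.Fin using (Fin; toℕ) renaming (zero to fz; suc to fs)
open import Data.Maybe using (Maybe; just; nothing; map)
open import Data.List using (List; []; _∷_; _++_)
open import Data.Product using (Σ; _×_; _,_; proj₁; proj₂)
open import Data.Sum using (_⊎_; inj₁; inj₂)
open import Data.Unit using (⊤; tt)
open import Data.Empty using (⊥)
open import Relation.Nullary using (¬_)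
open import Relation.Binary.PropositionalEquality

Step : {I : Set} → (I → Set) → Sig I → Set
Step R S = Σ (Sig.Inst S) (λ r → ∀ k → R (Sig.prem S r k))

-- Partial inverse of toℕ; it reads the index of a child off a path.
toFin? : (n : ℕ) → ℕ → Maybe (Fin n)
toFin? zero    _       = nothing
toFin? (suc n) zero    = just fz
toFin? (suc n) (suc m) = map fs (toFin? n m)

toFin?-toℕ : ∀ {n} (k : Fin n) → toFin? n (toℕ k) ≡ just k
toFin?-toℕ fz = refl
toFin?-toℕ (fs k) rewrite toFin?-toℕ k = refl

module Coinduction {I : Set} (rules : I → Sig I) where
  open Sig

  -- The node at a path is found by iterating the step
  -- along the path (out-of-range indices are never consulted).
  coinduction : (R : I → Set) → (∀ {i} → R i → Step R (rules i)) →
                ∀ {i} → R i → ν rules i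
  coinduction R step {i} ri = record
    { label = λ p → proj₁ (node p) , proj₁ (step (proj₂ (node p)))
    ; root  = refl
    ; next  = λ p k → child-judgment (node p) k }
    where
    child : Σ I R → ℕ → Σ I R
    child (j , rj) k with toFin? (arity (rules j) (proj₁ (step rj))) k
    ... | just f  = prem (rules j) (proj₁ (step rj)) f , proj₂ (step rj) f
    ... | nothing = j , rj

    node : List ℕ → Σ I R
    node []      = i , ri
    node (k ∷ p) = child (node p) k

    child-judgment : (x : Σ I R) (f : Fin (arity (rules (proj₁ x)) (proj₁ (step (proj₂ x))))) →
                     proj₁ (child x (toℕ f)) ≡ prem (rules (proj₁ x)) (proj₁ (step (proj₂ x))) f
    child-judgment (j , rj) f with toFin? (arity (rules j) (proj₁ (step rj))) (toℕ f) | toFin?-toℕ f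
    ... | just .f | refl = refl

  unfold : ∀ {i} → ν rules i → Step (ν rules) (rules i)
  unfold {i} n = subst (λ j → Step (ν rules) (rules j)) (ν.root n) at-root
    where
    at-root : Step (ν rules) (rules (proj₁ (ν.label n [])))
    at-root = proj₂ (ν.label n []) , λ k → record
      { label = λ q → ν.label n (q ++ toℕ k ∷ [])
      ; root  = ν.next n [] k
      ; next  = λ q k′ → ν.next n (q ++ toℕ k ∷ []) k′ }

  coinduction-upto : (R : I → Set) → (∀ {i} → R i → Step (λ j → R j ⊎ ν rules j) (rules i)) →
                     ∀ {i} → R i → ν rules i
  coinduction-upto R step r = coinduction (λ j → R j ⊎ ν rules j) step′ (inj₁ r)
    where
    step′ : ∀ {i} → R i ⊎ ν rules i → Step (λ j → R j ⊎ ν rules j) (rules i)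
    step′ (inj₁ x) = step x
    step′ (inj₂ n) = proj₁ (unfold n) , λ k → inj₂ (proj₂ (unfold n) k)

  fold : ∀ {i} → Step (ν rules) (rules i) → ν rules i
  fold = coinduction-upto (λ j → Step (ν rules) (rules j)) (λ y → proj₁ y , λ k → inj₂ (proj₂ y k))

hdV : View → State
hdV (nilV σ)    = σ
hdV (consV σ _) = σ

hd-out : ∀ τ → hdV (out τ) ≡ hd τ
hd-out τ = from-view (hd τ) (rest τ) (rest τ 0)
  where
  from-view : ∀ σ r m → hdV (viewFrom σ r m) ≡ σ
  from-view σ r nothing  = refl
  from-view σ r (just _) = refl

hd-nil : ∀ {τ σ} → out τ ≡ nilV σ → hd τ ≡ σ
hd-nil {τ} eq = trans (sym (hd-out τ)) (cong hdV eq)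

hd-cons : ∀ {τ σ t} → out τ ≡ consV σ t → hd τ ≡ σ
hd-cons {τ} eq = trans (sym (hd-out τ)) (cong hdV eq)

NilOf-eq : ∀ {σ} (v : View) → NilOf v σ → v ≡ nilV σ
NilOf-eq (nilV σ₀) refl = refl

ConsMatch : (Trace → Trace → Set) → State → Trace → Trace → Set
ConsMatch X σ t b = Σ State λ σ′ → Σ Trace λ t′ → (out b ≡ consV σ′ t′) × (σ ≡ σ′) × X t t′

BisimV : View → View → Set
BisimV (nilV σ)    (nilV σ′)     = σ ≡ σ′
BisimV (consV σ t) (consV σ′ t′) = (σ ≡ σ′) × (t ≈ t′)
BisimV _ _ = ⊥

bisim-out : ∀ {τ τ′} → τ ≈ τ′ → BisimV (out τ) (out τ′)
bisim-out {τ} {τ′} b = from-step (out τ) (out τ′) (Coinduction.unfold bisimRules b)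
  where
  from-step : (v v′ : View) → Step (ν bisimRules) (bisimV v v′) → BisimV v v′
  from-step (nilV σ)    (nilV σ′)     x = proj₁ x
  from-step (nilV σ)    (consV σ′ t′) x = proj₁ x
  from-step (consV σ t) (nilV σ′)     x = proj₁ x
  from-step (consV σ t) (consV σ′ t′) x = proj₁ x , proj₂ x fz

≈-hd : ∀ {τ τ′} → τ ≈ τ′ → hd τ ≡ hd τ′
≈-hd {τ} {τ′} b = trans (sym (hd-out τ)) (trans (hdV-bisim (out τ) (out τ′) (bisim-out b)) (hd-out τ′))
  where
  hdV-bisim : (v v′ : View) → BisimV v v′ → hdV v ≡ hdV v′
  hdV-bisim (nilV σ)    (nilV σ′)     b = b
  hdV-bisim (consV σ t) (consV σ′ t′) b = proj₁ b

≈-cons : ∀ {τ τ′ σ t} → τ ≈ τ′ → out τ ≡ consV σ t → ConsMatch _≈_ σ t τ′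
≈-cons {τ} {τ′} b eq = match (out τ′) (subst (λ v → BisimV v (out τ′)) eq (bisim-out b))
  where
  match : ∀ {σ t} (v : View) → BisimV (consV σ t) v →
          Σ State λ σ′ → Σ Trace λ t′ → (v ≡ consV σ′ t′) × (σ ≡ σ′) × (t ≈ t′)
  match (consV σ′ t′) (e , b′) = σ′ , t′ , refl , e , b′

NilOf-bisim : ∀ {σ} (v v′ : View) → BisimV v v′ → NilOf v σ → NilOf v′ σ
NilOf-bisim (nilV σ) (nilV σ′) b n = trans (sym b) n

DupOf-bisim : ∀ {σ σ′} (v v′ : View) → BisimV v v′ → DupOf v σ σ′ → DupOf v′ σ σ′
DupOf-bisim (consV σ t) (consV σ′ t′) (e , b) (e₁ , n) =
  trans (sym e) e₁ , NilOf-bisim (out t) (out t′) (bisim-out b) n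

-- followsRules, with its case split on the first trace made visible.
FollowsV : TPred → View → Trace → Sig (Trace × Trace)
FollowsV Q (nilV σ)    τ′ = leaf ((hd τ′ ≡ σ) × Q τ′)
FollowsV Q (consV σ t) τ′ = followsCons σ t (out τ′)

followsRules-out : ∀ Q τ τ′ → followsRules Q (τ , τ′) ≡ FollowsV Q (out τ) τ′
followsRules-out Q τ τ′ with out τ
... | nilV σ    = refl
... | consV σ t = refl

follows-unfold : ∀ {Q τ τ′} → follows Q τ τ′ → Step (ν (followsRules Q)) (FollowsV Q (out τ) τ′)
follows-unfold {Q} {τ} {τ′} f =
  subst (Step (ν (followsRules Q))) (followsRules-out Q τ τ′) (Coinduction.unfold (followsRules Q) f)

follows-nil : ∀ {Q τ τ′ σ} → follows Q τ τ′ → out τ ≡ nilV σ → (hd τ′ ≡ σ) × Q τ′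
follows-nil {Q} {τ} {τ′} f eq =
  proj₁ (subst (λ v → Step (ν (followsRules Q)) (FollowsV Q v τ′)) eq (follows-unfold f))

follows-cons : ∀ {Q τ τ′ σ t} → follows Q τ τ′ → out τ ≡ consV σ t → ConsMatch (follows Q) σ t τ′
follows-cons {Q} {τ} {τ′} f eq =
  match (out τ′) (subst (λ v → Step (ν (followsRules Q)) (FollowsV Q v τ′)) eq (follows-unfold f))
  where
  match : ∀ {σ t} (v : View) → Step (ν (followsRules Q)) (followsCons σ t v) →
          Σ State λ σ′ → Σ Trace λ t′ → (v ≡ consV σ′ t′) × (σ ≡ σ′) × follows Q t t′
  match (nilV _) (() , _)
  match (consV σ′ t′) (e , ch) = σ′ , t′ , refl , e , ch fz

follows-hd : ∀ {Q τ τ′} → follows Q τ τ′ → hd τ′ ≡ hd τ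
follows-hd {Q} {τ} {τ′} f with out τ in eq
... | nilV σ = trans (proj₁ (follows-nil f eq)) (sym (hd-nil eq))
... | consV σ t with follows-cons f eq
... | σ′ , t′ , eq′ , e , _ = trans (hd-cons eq′) (trans (sym e) (sym (hd-cons eq)))

follows-coinduction :
  ∀ {Q} (R : Trace × Trace → Set) →
  (∀ {a b σ} → R (a , b) → out a ≡ nilV σ → (hd b ≡ σ) × Q b) →
  (∀ {a b σ t} → R (a , b) → out a ≡ consV σ t →
     ConsMatch (λ t t′ → R (t , t′) ⊎ follows Q t t′) σ t b) →
  ∀ {a b} → R (a , b) → follows Q a b
follows-coinduction {Q} R at-nil at-cons = Coinduction.coinduction-upto (followsRules Q) R step
  where
  R⁺ : Trace × Trace → Set
  R⁺ j = R j ⊎ ν (followsRules Q) j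

  step : ∀ {p} → R p → Step R⁺ (followsRules Q p)
  step {a , b} r = subst (Step R⁺) (sym (followsRules-out Q a b)) (by-view (out a) refl)
    where
    by-view : (v : View) → out a ≡ v → Step R⁺ (FollowsV Q v b)
    by-view (nilV σ) eq = at-nil r eq , λ ()
    by-view (consV σ t) eq with at-cons r eq
    ... | σ′ , t′ , eq′ , e , x rewrite eq′ = e , λ _ → x

follows-refl : ∀ {τ} → follows IsNil τ τ
follows-refl = follows-coinduction (λ p → proj₁ p ≡ proj₂ p) at-nil at-cons refl
  where
  at-nil : ∀ {a c σ} → a ≡ c → out a ≡ nilV σ → (hd c ≡ σ) × IsNil c
  at-nil refl eq = hd-nil eq , subst ⟪ (λ _ → ⊤) ⟫V (sym eq) tt
  at-cons : ∀ {a c σ t} → a ≡ c → out a ≡ consV σ t →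
            ConsMatch (λ t t′ → (t ≡ t′) ⊎ follows IsNil t t′) σ t c
  at-cons {σ = σ} {t} refl eq = σ , t , eq , refl , inj₁ refl

FollowsDagV : TPred → View → Trace → Sig DagJ
FollowsDagV P (nilV σ)    τ′ = sig (hd τ′ ≡ σ) (λ _ → 1) (λ _ _ → dag τ′)
FollowsDagV P (consV σ t) τ′ = dagCons σ t (out τ′)

dagRules-out : ∀ P τ τ′ → dagRules P (dfol τ τ′) ≡ FollowsDagV P (out τ) τ′
dagRules-out P τ τ′ with out τ
... | nilV σ    = refl
... | consV σ t = refl

FollowsDag : TPred → Trace → Trace → Set
FollowsDag P w u = ν (dagRules P) (dfol w u)

dag-unfold : ∀ {P u} → (P †) u → IsNil u ⊎ Σ Trace (λ w → P w × FollowsDag P w u)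
dag-unfold {P} d with Coinduction.unfold (dagRules P) d
... | inj₁ x , _ = inj₁ x
... | inj₂ (w , pw) , ch = inj₂ (w , pw , ch fz)

followsDag-unfold : ∀ {P w u} → FollowsDag P w u → Step (ν (dagRules P)) (FollowsDagV P (out w) u)
followsDag-unfold {P} {w} {u} f =
  subst (Step (ν (dagRules P))) (dagRules-out P w u) (Coinduction.unfold (dagRules P) f)

followsDag-nil : ∀ {P w u σ} → FollowsDag P w u → out w ≡ nilV σ → (hd u ≡ σ) × (P †) u
followsDag-nil {P} {w} {u} f eq =
  let e , ch = subst (λ v → Step (ν (dagRules P)) (FollowsDagV P v u)) eq (followsDag-unfold f)
  in e , ch fz

followsDag-cons : ∀ {P w u σ t} → FollowsDag P w u → out w ≡ consV σ t → ConsMatch (FollowsDag P) σ t u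
followsDag-cons {P} {w} {u} f eq =
  match (out u) (subst (λ v → Step (ν (dagRules P)) (FollowsDagV P v u)) eq (followsDag-unfold f))
  where
  match : ∀ {σ t} (v : View) → Step (ν (dagRules P)) (dagCons σ t v) →
          Σ State λ σ′ → Σ Trace λ t′ → (v ≡ consV σ′ t′) × (σ ≡ σ′) × FollowsDag P t t′
  match (nilV _) (() , _)
  match (consV σ′ t′) (e , ch) = σ′ , t′ , refl , e , ch fz

followsDag-hd : ∀ {P w u} → FollowsDag P w u → hd u ≡ hd w
followsDag-hd {P} {w} {u} f with out w in eq
... | nilV σ = trans (proj₁ (followsDag-nil f eq)) (sym (hd-nil eq))
... | consV σ t with followsDag-cons f eq
... | σ′ , t′ , eq′ , e , _ = trans (hd-cons eq′) (trans (sym e) (sym (hd-cons eq)))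

⟪⟫-setoid : ∀ U → IsSetoid ⟪ U ⟫
⟪⟫-setoid U τ τ′ b u = by-view (out τ) (out τ′) (bisim-out b) u
  where
  by-view : (v v′ : View) → BisimV v v′ → ⟪ U ⟫V v → ⟪ U ⟫V v′
  by-view (nilV σ) (nilV σ′) b u = subst U b u

update-setoid : ∀ U x e → IsSetoid (U [ x ↦ₜ e ])
update-setoid U x e τ τ′ b d = by-view (out τ) (out τ′) (bisim-out b) d
  where
  by-view : (v v′ : View) → BisimV v v′ → updV U x e v → updV U x e v′
  by-view (consV σ t) (consV σ′ t′) (e₁ , b₁) (n , u) rewrite e₁ =
    NilOf-bisim (out t) (out t′) (bisim-out b₁) n , u

follows-resp-≈ : ∀ {Q} → IsSetoid Q → ∀ {a c c′} → follows Q a c → c ≈ c′ → follows Q a c′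
follows-resp-≈ {Q} Q-setoid f b = follows-coinduction R at-nil at-cons (_ , f , b)
  where
  R : Trace × Trace → Set
  R (a , c) = Σ Trace λ c₀ → follows Q a c₀ × (c₀ ≈ c)
  at-nil : ∀ {a c σ} → R (a , c) → out a ≡ nilV σ → (hd c ≡ σ) × Q c
  at-nil (c₀ , f , b) eq with follows-nil f eq
  ... | e , q = trans (sym (≈-hd b)) e , Q-setoid _ _ b q
  at-cons : ∀ {a c σ t} → R (a , c) → out a ≡ consV σ t →
            ConsMatch (λ t t′ → R (t , t′) ⊎ follows Q t t′) σ t c
  at-cons (c₀ , f , b) eq with follows-cons f eq
  ... | σ′ , t₀ , eq′ , e , f′ with ≈-cons b eq′
  ... | σ″ , t′ , eq″ , e′ , b′ = σ″ , t′ , eq″ , trans e e′ , inj₁ (t₀ , f′ , b′)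

**-setoid : ∀ {P Q} → IsSetoid Q → IsSetoid (P ** Q)
**-setoid Q-setoid τ τ′ b (τ₀ , p , f) = τ₀ , p , follows-resp-≈ Q-setoid f b

ev-unfold : ∀ {j} → ν evRules j → Step (ν evRules) (evRules j)
ev-unfold = Coinduction.unfold evRules

ev-fold : ∀ {j} → Step (ν evRules) (evRules j) → ν evRules j
ev-fold = Coinduction.fold evRules

evx-cons : ∀ {s τ τ′ σ t} → s , τ ⇒* τ′ → out τ ≡ consV σ t → ConsMatch (s ,_⇒*_) σ t τ′
evx-cons {s} {τ} {τ′} d eq =
  match (out τ′) (subst (λ v → Step (ν evRules) (evxRules s v τ′)) eq (ev-unfold d))
  where
  match : ∀ {σ t} (v : View) → Step (ν evRules) (evxCons s σ t v) →
          Σ State λ σ′ → Σ Trace λ t′ → (v ≡ consV σ′ t′) × (σ ≡ σ′) × (s , t ⇒* t′)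
  match (nilV _) (() , _)
  match (consV σ′ t′) (e , ch) = σ′ , t′ , refl , sym e , ch fz

evx-nil-intro : ∀ {s σ τ′} → s , σ ⇒ τ′ → s , ⟨ σ ⟩ ⇒* τ′
evx-nil-intro d = ev-fold (tt , λ _ → d)

evx-cons-intro : ∀ {s σ t τ′ t′} → out τ′ ≡ consV σ t′ → s , t ⇒* t′ → s , (σ ∷ᵗ t) ⇒* τ′
evx-cons-intro {s} {σ} {t} eq d =
  ev-fold (subst (λ v → Step (ν evRules) (evxCons s σ t v)) (sym eq) (refl , λ _ → d))

evx-dup-intro : ∀ {s σ τ′ t′} → out τ′ ≡ consV σ t′ → s , σ ⇒ t′ → s , (σ ∷ᵗ ⟨ σ ⟩) ⇒* τ′
evx-dup-intro eq d = evx-cons-intro eq (evx-nil-intro d)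

hdV-DupOf : ∀ {σ σ′} (v : View) → DupOf v σ σ′ → hdV v ≡ σ
hdV-DupOf (consV σ₀ t) (e , _) = e

hdV-NilOf : ∀ {σ} (v : View) → NilOf v σ → hdV v ≡ σ
hdV-NilOf (nilV σ₀) e = e

mutual
  hd-ev : ∀ s {σ τ} → s , σ ⇒ τ → hd τ ≡ σ
  hd-ev (x ≔ e) {σ} {τ} d = trans (sym (hd-out τ)) (hdV-DupOf (out τ) (proj₁ (ev-unfold d)))
  hd-ev skip {σ} {τ} d = trans (sym (hd-out τ)) (hdV-NilOf (out τ) (proj₁ (ev-unfold d)))
  hd-ev (s₀ ⨾ s₁) d with ev-unfold d
  ... | _ , ch = trans (hd-evx s₁ (ch (fs fz))) (hd-ev s₀ (ch fz))
  hd-ev (if e then sₜ else′ s_f) d with ev-unfold d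
  ... | inj₁ _ , ch = hd-evx sₜ (ch fz)
  ... | inj₂ _ , ch = hd-evx s_f (ch fz)
  hd-ev (while e loop b) {σ} {τ} d with ev-unfold d
  ... | wFalse _ dp , _ = trans (sym (hd-out τ)) (hdV-DupOf (out τ) dp)
  ... | wTrue _ _ , ch with evx-cons (ch fz) refl
  ... | σ′ , _ , eq′ , e′ , _ with evx-cons (ch (fs fz)) eq′
  ... | σ″ , _ , eq″ , e″ , _ = trans (hd-cons eq″) (sym (trans e′ e″))

  hd-evx : ∀ s {τ τ′} → s , τ ⇒* τ′ → hd τ′ ≡ hd τ
  hd-evx s {τ} {τ′} d with out τ in eq
  ... | nilV σ = trans (hd-ev s (proj₂ (subst (λ v → Step (ν evRules) (evxRules s v τ′)) eq (ev-unfold d)) fz))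
                       (sym (hd-nil eq))
  ... | consV σ t with evx-cons d eq
  ... | σ′ , t′ , eq′ , e , _ = trans (hd-cons eq′) (trans (sym e) (sym (hd-cons eq)))

-- Evaluation respects bisimilarity of its output trace.  The invariant
-- relates a derivation with output u to the judgment with output u′ ≈ u.
data EvUpTo≈ : EvJ → Set where
  ev-upto  : ∀ {s σ τ τ′} → s , σ ⇒ τ → τ ≈ τ′ → EvUpTo≈ (ev s σ τ′)
  evx-upto : ∀ {s t u u′} → s , t ⇒* u → u ≈ u′ → EvUpTo≈ (evx s t u′)

private
  EvUpTo≈⁺ : EvJ → Set
  EvUpTo≈⁺ j = EvUpTo≈ j ⊎ ν evRules j

  evUpTo≈-cons : ∀ {s σ t} (vu vt : View) → BisimV vu vt → Step (ν evRules) (evxCons s σ t vu) →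
                 Step EvUpTo≈⁺ (evxCons s σ t vt)
  evUpTo≈-cons (nilV _) _ _ (() , _)
  evUpTo≈-cons (consV σ′ u₁) (consV σ″ t₁) (e₁ , b₁) (eq , ch) =
    trans (sym e₁) eq , λ k → inj₁ (evx-upto (ch k) b₁)

  evUpTo≈-step : ∀ {j} → EvUpTo≈ j → Step EvUpTo≈⁺ (evRules j)
  evUpTo≈-step (ev-upto {x ≔ e} {σ} {τ} {τ′} d b) =
    DupOf-bisim (out τ) (out τ′) (bisim-out b) (proj₁ (ev-unfold d)) , λ ()
  evUpTo≈-step (ev-upto {skip} {σ} {τ} {τ′} d b) =
    NilOf-bisim (out τ) (out τ′) (bisim-out b) (proj₁ (ev-unfold d)) , λ ()
  evUpTo≈-step (ev-upto {s₀ ⨾ s₁} d b) with ev-unfold d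
  ... | τ₀ , ch = τ₀ , λ { fz → inj₂ (ch fz) ; (fs _) → inj₁ (evx-upto (ch (fs fz)) b) }
  evUpTo≈-step (ev-upto {if e then sₜ else′ s_f} d b) with ev-unfold d
  ... | inj₁ p , ch = inj₁ p , λ k → inj₁ (evx-upto (ch k) b)
  ... | inj₂ p , ch = inj₂ p , λ k → inj₁ (evx-upto (ch k) b)
  evUpTo≈-step (ev-upto {while e loop s} {σ} {τ} {τ′} d b) with ev-unfold d
  ... | wTrue p τ₀ , ch = wTrue p τ₀ , λ { fz → inj₂ (ch fz) ; (fs _) → inj₁ (evx-upto (ch (fs fz)) b) }
  ... | wFalse p dp , _ = wFalse p (DupOf-bisim (out τ) (out τ′) (bisim-out b) dp) , λ ()
  evUpTo≈-step (evx-upto {s} {t} {u} {u′} d b) = by-view (out t) (ev-unfold d)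
    where
    by-view : (v : View) → Step (ν evRules) (evxRules s v u) → Step EvUpTo≈⁺ (evxRules s v u′)
    by-view (nilV σ) (_ , ch) = tt , λ k → inj₁ (ev-upto (ch k) b)
    by-view (consV σ t₁) x = evUpTo≈-cons (out u) (out u′) (bisim-out b) x

ev-resp-≈ : ∀ {s σ τ τ′} → s , σ ⇒ τ → τ ≈ τ′ → s , σ ⇒ τ′
ev-resp-≈ d b = Coinduction.coinduction-upto evRules EvUpTo≈ evUpTo≈-step (ev-upto d b)

-- If every Q-trace is an evaluation of s from its head, then
-- follows_Q(τ, τ′) yields  s , τ ⇒* τ′: both relations walk along τ and
-- finish with such a trace.
follows-evx : ∀ {s Q} → (∀ t → Q t → s , hd t ⇒ t) → ∀ {τ τ′} → follows Q τ τ′ → s , τ ⇒* τ′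
follows-evx {s} {Q} Q-ev f = Coinduction.coinduction-upto evRules Fol step (from-follows f)
  where
  data Fol : EvJ → Set where
    from-follows : ∀ {a b} → follows Q a b → Fol (evx s a b)

  step : ∀ {j} → Fol j → Step (λ i → Fol i ⊎ ν evRules i) (evRules j)
  step (from-follows {a} {b} f) = by-view (out a) refl
    where
    by-view : (v : View) → out a ≡ v → Step (λ i → Fol i ⊎ ν evRules i) (evxRules s v b)
    by-view (nilV σ) eq with follows-nil f eq
    ... | e , q = tt , λ _ → inj₂ (subst (λ x → s , x ⇒ b) e (Q-ev b q))
    by-view (consV σ t) eq with follows-cons f eq
    ... | σ′ , t′ , eq′ , e , f′ rewrite eq′ = sym e , λ _ → inj₁ (from-follows f′)

⟪⟫-inv : ∀ {X τ} → ⟪ X ⟫ τ → (out τ ≡ nilV (hd τ)) × X (hd τ)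
⟪⟫-inv {X} {τ} x = by-view (out τ) refl x
  where
  by-view : (v : View) → out τ ≡ v → ⟪ X ⟫V v → (out τ ≡ nilV (hd τ)) × X (hd τ)
  by-view (nilV σ) eq x = subst (λ σ′ → (out τ ≡ nilV σ′) × X σ′) (sym (hd-nil eq)) (eq , x)

dup-inv : ∀ {X τ} → dup X τ → Σ Trace λ t → (out τ ≡ consV (hd τ) t) × (out t ≡ nilV (hd τ)) × X (hd τ)
dup-inv {X} {τ} d = by-view (out τ) refl d
  where
  by-view : (v : View) → out τ ≡ v → dupV X v →
            Σ Trace λ t → (out τ ≡ consV (hd τ) t) × (out t ≡ nilV (hd τ)) × X (hd τ)
  by-view (consV σ t) eq (n , x) =
    subst (λ σ′ → Σ Trace λ t → (out τ ≡ consV σ′ t) × (out t ≡ nilV σ′) × X σ′)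
          (sym (hd-cons eq)) (t , eq , NilOf-eq (out t) n , x)

dup**-inv : ∀ {U Q τ′} → (dup U ** Q) τ′ →
            Σ State λ σ → Σ Trace λ t′ → (out τ′ ≡ consV σ t′) × U σ × Q t′ × (hd t′ ≡ σ)
dup**-inv {τ′ = τ′} (τ , d , f) with dup-inv d
... | t , eq , eqt , u with follows-cons f eq
... | σ′ , t′ , eq′ , e , f′ with follows-nil f′ eqt
... | hd-t′ , q = hd τ , t′ , subst (λ σ → out τ′ ≡ consV σ t′) (sym e) eq′ , u , q , hd-t′

sp : Assn → Stmt → TPred
sp U s τ = Σ State (λ σ → U σ × s , σ ⇒ τ)

sp-setoid : ∀ U s → IsSetoid (sp U s)
sp-setoid U s τ τ′ b (σ , u , d) = σ , u , ev-resp-≈ d b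

sp-hd : ∀ {V s t σ} → sp V s t → hd t ≡ σ → V σ × s , σ ⇒ t
sp-hd {V} {s} {t} (σ₀ , v , d) e = subst (λ σ → V σ × s , σ ⇒ t) (trans (sym (hd-ev s d)) e) (v , d)

⊤ₐ : Assn
⊤ₐ _ = ⊤

**-unit : ∀ P → P ⊨ₜ (P ** IsNil)
**-unit P τ p = τ , p , follows-refl

_∪ₜ_ : TPred → TPred → TPred
(P ∪ₜ Q) τ = P τ ⊎ Q τ

∪-setoid : ∀ {P Q} → IsSetoid P → IsSetoid Q → IsSetoid (P ∪ₜ Q)
∪-setoid P-setoid Q-setoid τ τ′ b (inj₁ p) = inj₁ (P-setoid τ τ′ b p)
∪-setoid P-setoid Q-setoid τ τ′ b (inj₂ q) = inj₂ (Q-setoid τ τ′ b q)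

assign-sp : ∀ U x e → (U [ x ↦ₜ e ]) ⊨ₜ sp U (x ≔ e)
assign-sp U x e τ p = by-view (out τ) refl p
  where
  by-view : (v : View) → out τ ≡ v → updV U x e v → sp U (x ≔ e) τ
  by-view (consV σ t) eq (n , u) =
    σ , u , ev-fold (subst (λ v → DupOf v σ (σ [ x ↦ ⟦ e ⟧ σ ])) (sym eq) (refl , n) , λ ())

skip-sp : ∀ U → ⟪ U ⟫ ⊨ₜ sp U skip
skip-sp U τ p with ⟪⟫-inv p
... | eq , u = hd τ , u , ev-fold (subst (λ v → NilOf v (hd τ)) (sym eq) refl , λ ())

seq-sp : ∀ U s₀ s₁ → (sp U s₀ ** sp ⊤ₐ s₁) ⊨ₜ sp U (s₀ ⨾ s₁)
seq-sp U s₀ s₁ τ′ (τ , (σ , u , d) , f) =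
  σ , u , ev-fold (τ , λ { fz → d ; (fs _) → follows-evx (λ t p → proj₂ (sp-hd p refl)) f })

if-sp : ∀ U e sₜ s_f →
        (dup U ** (sp (e ∧ₑ U) sₜ ∪ₜ sp (e ∧¬ₑ U) s_f)) ⊨ₜ sp U (if e then sₜ else′ s_f)
if-sp U e sₜ s_f τ′ p with dup**-inv p
... | σ , t′ , eq , u , inj₁ q , hd-t′ with sp-hd q hd-t′
...   | (guard , _) , d = σ , u , ev-fold (inj₁ guard , λ _ → evx-dup-intro eq d)
if-sp U e sₜ s_f τ′ p | σ , t′ , eq , u , inj₂ q , hd-t′ with sp-hd q hd-t′
...   | (guard , _) , d = σ , u , ev-fold (inj₂ guard , λ _ → evx-dup-intro eq d)

-- With invariant true, the Hoare rule describes a loop trace as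
-- σ :: (a sequence of iterations, each a body trace from a state satisfying
-- the guard followed by a duplicated state) followed by a final state
-- violating the guard.  Reading such a trace back as an evaluation of the
-- loop is a coinduction with three kinds of intermediate judgments.
module Loop (e : Expr) (b : Stmt) where
  Body : TPred
  Body = sp (e ∧ₑ ⊤ₐ) b

  Iteration : TPred
  Iteration = Body ** dup ⊤ₐ

  Exit : TPred
  Exit = ⟪ (λ σ → ¬ (σ ⊨ e)) ⟫

  loop : Stmt
  loop = while e loop b

  data Run : EvJ → Set where
    -- a loop evaluation from σ with output σ :: t′, where t′ is a sequence u
    -- of iterations starting at σ followed by the exit state
    start  : ∀ {σ τ′ t′ u} → out τ′ ≡ consV σ t′ → (Iteration †) u → follows Exit u t′ →
             hd u ≡ σ → Run (ev loop σ τ′)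
    -- the loop resumed on the remainder v of a body trace; w is v followed by
    -- the duplicated final state, u is w followed by the remaining iterations
    resume : ∀ {v t′ w u} → follows (dup ⊤ₐ) v w → FollowsDag Iteration w u →
             follows Exit u t′ → Run (evx loop v t′)
    -- a state shared by the body trace and the output
    shift  : ∀ {σ v τ′ t′} → out τ′ ≡ consV σ t′ → Run (evx loop v t′) →
             Run (evx loop (σ ∷ᵗ v) τ′)

  Run⁺ : EvJ → Set
  Run⁺ j = Run j ⊎ ν evRules j

  -- At the start the sequence of iterations is either empty, and the loop
  -- exits, or begins with a body trace v from σ, and the loop iterates.
  start-step : ∀ {σ τ′ t′ u} → out τ′ ≡ consV σ t′ → (Iteration †) u → follows Exit u t′ →
               hd u ≡ σ → Step Run⁺ (evRules (ev loop σ τ′))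
  start-step {σ} {τ′} {t′} {u} eq iterations exit hd-u with dag-unfold iterations
  ... | inj₁ none with ⟪⟫-inv none
  ...   | eq-u , _ with follows-nil exit eq-u
  ...     | hd-t′ , final with ⟪⟫-inv final
  ...       | eq-t′ , ¬guard =
    let hd-t′≡σ = trans hd-t′ hd-u
    in wFalse (subst (λ x → ¬ (x ⊨ e)) hd-t′≡σ ¬guard)
              (subst (λ v → DupOf v σ σ) (sym eq) (refl , subst (λ v → NilOf v σ) (sym eq-t′) hd-t′≡σ))
       , λ ()
  start-step {σ} {τ′} {t′} {u} eq iterations exit hd-u | inj₂ (w , (v , body , to-w) , to-u) =
    wTrue (proj₁ (proj₁ first-body)) (σ ∷ᵗ v) ,
    λ { fz → inj₂ (evx-dup-intro refl (proj₂ first-body))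
      ; (fs _) → inj₁ (shift eq (resume to-w to-u exit)) }
    where
    first-body : (e ∧ₑ ⊤ₐ) σ × b , σ ⇒ v
    first-body = sp-hd body (trans (sym (follows-hd to-w)) (trans (sym (followsDag-hd to-u)) hd-u))

  -- Inside a body trace all three relations advance together; at its end the
  -- duplicated state is consumed and the loop starts again.
  resume-step : ∀ {v t′ w u} → follows (dup ⊤ₐ) v w → FollowsDag Iteration w u →
                follows Exit u t′ → Step Run⁺ (evRules (evx loop v t′))
  resume-step {v} {t′} {w} {u} to-w to-u exit = by-view (out v) refl
    where
    by-view : (x : View) → out v ≡ x → Step Run⁺ (evxRules loop x t′)
    by-view (consV σ v₂) eq with follows-cons to-w eq
    ... | σ₁ , w₂ , eq-w , e₁ , to-w₂ with followsDag-cons to-u eq-w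
    ... | σ₂ , u₂ , eq-u , e₂ , to-u₂ with follows-cons exit eq-u
    ... | σ₃ , t₂ , eq-t , e₃ , exit₂ rewrite eq-t =
      sym (trans e₁ (trans e₂ e₃)) , λ _ → inj₁ (resume to-w₂ to-u₂ exit₂)
    by-view (nilV σ) eq with follows-nil to-w eq
    ... | hd-w , dup-w with dup-inv dup-w
    ... | w₂ , eq-w , eq-w₂ , _ with followsDag-cons to-u eq-w
    ... | σ₂ , u₂ , eq-u , e₂ , to-u₂ with followsDag-nil to-u₂ eq-w₂
    ... | hd-u₂ , iterations with follows-cons exit eq-u
    ... | σ₃ , t₂ , eq-t , e₃ , exit₂ =
      tt , λ _ → inj₁ (start (subst (λ x → out t′ ≡ consV x t₂) (trans (sym e₃) (trans (sym e₂) hd-w)) eq-t)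
                             iterations exit₂ (trans hd-u₂ hd-w))

  run-step : ∀ {j} → Run j → Step Run⁺ (evRules j)
  run-step (start eq iterations exit hd-u) = start-step eq iterations exit hd-u
  run-step (resume to-w to-u exit) = resume-step to-w to-u exit
  run-step (shift {σ} {v} eq r) =
    subst (λ x → Step Run⁺ (evxCons loop σ v x)) (sym eq) (refl , λ _ → inj₁ r)

  while-sp : ∀ U → (dup U ** ((Iteration †) ** Exit)) ⊨ₜ sp U loop
  while-sp U τ′ p with dup**-inv p
  ... | σ , t′ , eq , u , (u₀ , iterations , exit) , hd-t′ =
    σ , u , Coinduction.coinduction-upto evRules Run run-step
              (start eq iterations exit (trans (sym (follows-hd exit)) hd-t′))

weaken : ∀ {U P′ P s} → IsSetoid P′ → IsSetoid P → ⊢[ U ] s [ P′ ] → P′ ⊨ₜ P → ⊢[ U ] s [ P ]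
weaken P′-setoid P-setoid d P′⊨P = h-conseq P′-setoid P-setoid (λ _ u → u) d P′⊨P

-- The form of the strongest postcondition required of a body by h-seq and h-while.
extend : ∀ {V s} → ⊢[ V ] s [ sp V s ] → ⊢[ V ] s [ sp V s ** IsNil ]
extend {V} {s} d = weaken (sp-setoid V s) (**-setoid (⟪⟫-setoid ⊤ₐ)) d (**-unit (sp V s))

sp-derivable : ∀ s U → ⊢[ U ] s [ sp U s ]
sp-derivable (x ≔ e) U = weaken (update-setoid U x e) (sp-setoid U _) h-assign (assign-sp U x e)
sp-derivable skip U = weaken (⟪⟫-setoid U) (sp-setoid U _) h-skip (skip-sp U)
sp-derivable (s₀ ⨾ s₁) U =
  weaken (**-setoid (sp-setoid ⊤ₐ s₁)) (sp-setoid U _)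
    (h-seq (sp-setoid U s₀) (sp-setoid ⊤ₐ s₁) (extend (sp-derivable s₀ U)) (sp-derivable s₁ ⊤ₐ))
    (seq-sp U s₀ s₁)
sp-derivable (if e then sₜ else′ s_f) U =
  weaken (**-setoid branches-setoid) (sp-setoid U _)
    (h-if branches-setoid
      (weaken (sp-setoid _ sₜ) branches-setoid (sp-derivable sₜ _) (λ _ → inj₁))
      (weaken (sp-setoid _ s_f) branches-setoid (sp-derivable s_f _) (λ _ → inj₂)))
    (if-sp U e sₜ s_f)
  where
  branches-setoid : IsSetoid (sp (e ∧ₑ U) sₜ ∪ₜ sp (e ∧¬ₑ U) s_f)
  branches-setoid = ∪-setoid (sp-setoid _ sₜ) (sp-setoid _ s_f)
sp-derivable (while e loop b) U =
  weaken (**-setoid (**-setoid (⟪⟫-setoid _))) (sp-setoid U _)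
    (h-while (sp-setoid _ b) (λ _ _ → tt) (extend (sp-derivable b _)))
    (Loop.while-sp e b U)

proposition3p17 : (s : Stmt) (U : Assn) (P : TPred) → IsSetoid P →
    ((σ : State) (τ : Trace) → U σ → s , σ ⇒ τ → P τ) →
    ⊢[ U ] s [ P ]
proposition3p17 s U P P-setoid sound =
  weaken (sp-setoid U s) P-setoid (sp-derivable s U) (λ τ (σ , u , d) → sound σ τ u d)
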